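{- Let $T$ be a $6$-tournament. Then (i) there exists a $6$-tournament $T'$ switching equivalent to $T$ such that $T'$ contains a transitive $4$-subtournament; (ii) if moreover $\delta_T<6$, then there exists a $6$-tournament $T''$ switching equivalent to $T$ such that $T''$ contains a transitive $5$-subtournament.
   Context: A tournament is a directed graph with exactly one arc between each pair of distinct vertices. A tournament is transitive if it has no directed 3-cycle. A $k$-subtournament is a subtournament induced by a $k$-element vertex subset. The switch of $T$ with respect to $W\subseteq V(T)$ is obtained by reversing all arcs between $W$ and $V(T)\setminus W$; switching equivalent means one is a switch of the other (on the same vertex set). A diamond is a 4-tournament consisting of a directed 3-cycle together with a vertex that either dominates all three cycle vertices or is dominated by all three; $\delta_T$ is the number of 4-vertex subsets of $V(T)$ inducing a diamond. -}

module Defs where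

open import Data.Nat using (ℕ; _<_; _+_; _<?_)
open import Data.Fin using (Fin; toℕ)

open import Data.Bool using (Bool; true; false; not; _∧_; _∨_; _xor_; if_then_else_)
open import Data.List using (List; []; _∷_; concatMap; allFin)
open import Data.Product using (Σ; _×_)
open import Relation.Binary.PropositionalEquality using (_≡_; _≢_)
open import Relation.Nullary using (¬_)
open import Relation.Nullary.Decidable using (⌊_⌋)
open import Function.Definitions using (Injective)

-- A tournament on vertex set Fin n: arc i j = true means the arc i → j.
record Tournament (n : ℕ) : Set where
  field
    arc       : Fin n → Fin n → Bool
    irrefl    : ∀ i → arc i i ≡ false
    tourn     : ∀ i j → i ≢ j → arc j i ≡ not (arc i j)
open Tournament public

-- switch with respect to W ⊆ V(T) (W given by its indicator function):
-- reverse exactly the arcs between W and its complement.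
switchArc : ∀ {n} → (Fin n → Fin n → Bool) → (Fin n → Bool) → Fin n → Fin n → Bool
switchArc a W i j = if W i xor W j then a j i else a i j

IsSwitchOf : ∀ {n} → Tournament n → Tournament n → Set
IsSwitchOf {n} T' T = Σ (Fin n → Bool) λ W → ∀ i j → arc T' i j ≡ switchArc (arc T) W i j

SwitchingEquivalent : ∀ {n} → Tournament n → Tournament n → Set
SwitchingEquivalent T T' = IsSwitchOf T' T

Is3Cycle : ∀ {n} → Tournament n → Fin n → Fin n → Fin n → Set
Is3Cycle T x y z = (arc T x y ≡ true) × (arc T y z ≡ true) × (arc T z x ≡ true)

-- T contains a transitive k-subtournament: there is a k-element vertex set
-- (given as an injection Fin k → Fin n) whose induced subtournament has no
-- directed 3-cycle.
HasTransitiveSub : ∀ {n} → ℕ → Tournament n → Set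
HasTransitiveSub {n} k T =
  Σ (Fin k → Fin n) λ f → Injective _≡_ _≡_ f ×
    (∀ a b c → ¬ Is3Cycle T (f a) (f b) (f c))

cyc3? : ∀ {n} → Tournament n → Fin n → Fin n → Fin n → Bool
cyc3? T x y z = (arc T x y ∧ arc T y z ∧ arc T z x) ∨ (arc T x z ∧ arc T z y ∧ arc T y x)

apex? : ∀ {n} → Tournament n → Fin n → Fin n → Fin n → Fin n → Bool
apex? T v x y z = (arc T v x ∧ arc T v y ∧ arc T v z) ∨ (arc T x v ∧ arc T y v ∧ arc T z v)

isDiamond : ∀ {n} → Tournament n → Fin n → Fin n → Fin n → Fin n → Bool
isDiamond T a b c d =
     (cyc3? T b c d ∧ apex? T a b c d)
  ∨  (cyc3? T a c d ∧ apex? T b a c d)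
  ∨  (cyc3? T a b d ∧ apex? T c a b d)
  ∨  (cyc3? T a b c ∧ apex? T d a b c)

-- all 4-element subsets of Fin n, as strictly increasing quadruples
record Quad (n : ℕ) : Set where
  constructor quad
  field q₁ q₂ q₃ q₄ : Fin n

lt? : ∀ {n} → Fin n → Fin n → Bool
lt? i j = ⌊ toℕ i <? toℕ j ⌋

fourSubsets : (n : ℕ) → List (Quad n)
fourSubsets n =
  concatMap (λ a → concatMap (λ b → concatMap (λ c → concatMap (λ d →
    if lt? a b ∧ lt? b c ∧ lt? c d then quad a b c d ∷ [] else [])
    (allFin n)) (allFin n)) (allFin n)) (allFin n)

countB : ∀ {A : Set} → (A → Bool) → List A → ℕ
countB p []       = 0
countB p (x ∷ xs) = (if p x then 1 else 0) + countB p xs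

δ : ∀ {n} → Tournament n → ℕ
δ {n} T = countB (λ { (quad a b c d) → isDiamond T a b c d }) (fourSubsets n)

-- Diamonds are preserved by switching (a finite check on four vertices, transported to every
-- 4-subset through induced subtournaments), hence so is δ. Switching at the in-neighbourhood of a
-- vertex makes it a source, so every switching class contains a tournament in which vertex 0
-- dominates all others, i.e. a 5-tournament with a source added. For each of these 2¹⁰ tournaments
-- a certificate is found by search: a vertex v and a vertex set X that is transitive once v has been
-- switched into a source; for 5-sets such a certificate exists whenever δ < 6. Two successive
-- switches are a single switch, so the certificate gives a switch of the original tournament.

module Submission where

open import Defs
open import Data.Nat using (ℕ; zero; suc; _+_; _<_; _≤_; _<ᵇ_; _≤ᵇ_; _≡ᵇ_)
open import Data.Nat.Properties using (<-trans; <⇒≢; <⇒≱; <⇒<ᵇ; ≤ᵇ⇒≤; ≡ᵇ⇒≡; ≡⇒≡ᵇ)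
open import Data.Fin using (Fin; zero; suc; toℕ; #_) renaming (_<_ to _<ᶠ_)
open import Data.Fin.Properties using (suc-injective; toℕ-injective)
  renaming (<-cmp to <-cmpᶠ; <-trans to <-transᶠ)
open import Data.Bool using (Bool; true; false; not; T; _∧_; _∨_; _xor_; if_then_else_)
open import Data.Bool.Properties using (not-involutive; ∨-zeroʳ; ∧-conicalˡ; ∧-conicalʳ; T-≡; T-∧; T-∨) renaming (_≟_ to _≟ᵇ_)
open import Data.Vec as Vec using (Vec; []; _∷_; lookup; tabulate; replicate)
open import Data.Vec.Properties using (lookup∘tabulate; lookup-replicate)
open import Data.List using (List; []; _∷_; _++_; map; concatMap; allFin; cartesianProductWith)
open import Data.Bool.ListAction using (all; any)
open import Data.List.Relation.Unary.All as All using (All; []; _∷_)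
open import Data.List.Relation.Unary.All.Properties using (concat⁺; map⁺; all⁺; tabulate⁻)
import Data.List.Relation.Unary.Any as Any
open import Data.List.Relation.Unary.Any.Properties using (any⁻)
open import Data.Product using (Σ; _×_; _,_; proj₁; proj₂)
open import Data.Sum using ([_,_])
open import Data.Empty using (⊥-elim)
open import Function using (_∘_)
open import Function.Bundles using (Equivalence)
open import Function.Definitions using (Injective)
open import Relation.Binary.Definitions using (tri<; tri≈; tri>)
open import Relation.Binary.PropositionalEquality
  using (_≡_; _≢_; _≗_; refl; sym; trans; cong; cong₂; subst; module ≡-Reasoning)
open import Relation.Nullary using (¬_)
open import Relation.Nullary.Decidable using (⌊_⌋; toWitness)

private variable k n : ℕ

infix 4 _≋_
record _≋_ (R S : Tournament n) : Set where
  constructor mk≋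
  field same-arc : ∀ i j → arc R i j ≡ arc S i j
open _≋_

≋-sym : {R S : Tournament n} → R ≋ S → S ≋ R
≋-sym R≋S = mk≋ λ i j → sym (same-arc R≋S i j)

≋-trans : {R S U : Tournament n} → R ≋ S → S ≋ U → R ≋ U
≋-trans R≋S S≋U = mk≋ λ i j → trans (same-arc R≋S i j) (same-arc S≋U i j)

-- Switching

switch : Tournament n → (Fin n → Bool) → Tournament n
switch S W = record { arc = switchArc (arc S) W ; irrefl = irrefl′ ; tourn = tourn′ }
  where
  irrefl′ : ∀ i → switchArc (arc S) W i i ≡ false
  irrefl′ i with W i xor W i
  ... | true  = irrefl S i
  ... | false = irrefl S i
  tourn′ : ∀ i j → i ≢ j → switchArc (arc S) W j i ≡ not (switchArc (arc S) W i j)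
  tourn′ i j i≢j with W i | W j
  ... | true  | true  = tourn S i j i≢j
  ... | false | false = tourn S i j i≢j
  ... | true  | false = tourn S j i (i≢j ∘ sym)
  ... | false | true  = tourn S j i (i≢j ∘ sym)

switch-cong : {R S : Tournament n} {V W : Fin n → Bool} → R ≋ S → V ≗ W → switch R V ≋ switch S W
switch-cong {R = R} {S} {V} {W} (mk≋ e) V≗W = mk≋ same
  where
  same : ∀ i j → switchArc (arc R) V i j ≡ switchArc (arc S) W i j
  same i j rewrite V≗W i | V≗W j | e i j | e j i = refl

switch-switch : (S : Tournament n) (V W : Fin n → Bool) →
                switch (switch S V) W ≋ switch S (λ u → V u xor W u)
switch-switch S V W = mk≋ λ i j → lemma (V i) (V j) (W i) (W j) (arc S i j) (arc S j i)
  where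
  lemma : ∀ vi vj wi wj x y →
          (if wi xor wj then (if vj xor vi then x else y) else (if vi xor vj then y else x))
          ≡ (if (vi xor wi) xor (vj xor wj) then y else x)
  lemma true  true  true  true  x y = refl
  lemma true  true  true  false x y = refl
  lemma true  true  false true  x y = refl
  lemma true  true  false false x y = refl
  lemma true  false true  true  x y = refl
  lemma true  false true  false x y = refl
  lemma true  false false true  x y = refl
  lemma true  false false false x y = refl
  lemma false true  true  true  x y = refl
  lemma false true  true  false x y = refl
  lemma false true  false true  x y = refl
  lemma false true  false false x y = refl
  lemma false false true  true  x y = refl
  lemma false false true  false x y = refl
  lemma false false false true  x y = refl
  lemma false false false false x y = refl

inNeighbours : Tournament n → Fin n → Fin n → Bool
inNeighbours S v u = arc S u v

IsSource : Tournament n → Fin n → Set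
IsSource S v = ∀ u → u ≢ v → arc S v u ≡ true

switch-inNeighbours-isSource : (S : Tournament n) (v : Fin n) → IsSource (switch S (inNeighbours S v)) v
switch-inNeighbours-isSource S v u u≢v rewrite irrefl S v with arc S u v in uv
... | true  = refl
... | false = trans (tourn S u v u≢v) (cong not uv)

extend : Vec Bool n → Tournament n → Tournament (suc n)
extend {n} r S = record { arc = arc′ ; irrefl = irrefl′ ; tourn = tourn′ }
  where
  arc′ : Fin (suc n) → Fin (suc n) → Bool
  arc′ zero    zero    = false
  arc′ zero    (suc j) = lookup r j
  arc′ (suc i) zero    = not (lookup r i)
  arc′ (suc i) (suc j) = arc S i j
  irrefl′ : ∀ i → arc′ i i ≡ false
  irrefl′ zero    = refl
  irrefl′ (suc i) = irrefl S i
  tourn′ : ∀ i j → i ≢ j → arc′ j i ≡ not (arc′ i j)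
  tourn′ zero    zero    i≢j = ⊥-elim (i≢j refl)
  tourn′ zero    (suc j) _   = refl
  tourn′ (suc i) zero    _   = sym (not-involutive (lookup r i))
  tourn′ (suc i) (suc j) i≢j = tourn S i j (i≢j ∘ cong suc)

extend-cong : {R S : Tournament n} (r : Vec Bool n) → R ≋ S → extend r R ≋ extend r S
extend-cong r R≋S = mk≋ λ
  { zero    zero    → refl
  ; zero    (suc j) → refl
  ; (suc i) zero    → refl
  ; (suc i) (suc j) → same-arc R≋S i j
  }

removeZero : Tournament (suc n) → Tournament n
removeZero S = record
  { arc    = λ i j → arc S (suc i) (suc j)
  ; irrefl = λ i → irrefl S (suc i)
  ; tourn  = λ i j i≢j → tourn S (suc i) (suc j) (i≢j ∘ suc-injective)
  }

outRow : Tournament (suc n) → Vec Bool n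
outRow S = tabulate (arc S zero ∘ suc)

extend-outRow-removeZero : (S : Tournament (suc n)) → extend (outRow S) (removeZero S) ≋ S
extend-outRow-removeZero S = mk≋ λ
  { zero    zero    → sym (irrefl S zero)
  ; zero    (suc j) → lookup∘tabulate _ j
  ; (suc i) zero    → trans (cong not (lookup∘tabulate _ i)) (sym (tourn S zero (suc i) λ ()))
  ; (suc i) (suc j) → refl
  }

addSource : Tournament n → Tournament (suc n)
addSource {n} = extend (replicate n true)

addSource-cong : {R S : Tournament n} → R ≋ S → addSource R ≋ addSource S
addSource-cong = extend-cong _

addSource-removeZero : (S : Tournament (suc n)) → IsSource S zero → addSource (removeZero S) ≋ S
addSource-removeZero S source = mk≋ λ
  { zero    zero    → sym (irrefl S zero)
  ; zero    (suc j) → trans (lookup-replicate j true) (sym (source (suc j) λ ()))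
  ; (suc i) zero    → trans (cong not (lookup-replicate i true))
                            (sym (trans (tourn S zero (suc i) λ ()) (cong not (source (suc i) λ ()))))
  ; (suc i) (suc j) → refl
  }

∀ᵇ : (Fin k → Bool) → Bool
∀ᵇ p = all p (allFin _)

∀ᵇ-sound : {p : Fin k → Bool} → T (∀ᵇ p) → ∀ i → T (p i)
∀ᵇ-sound {p = p} h = tabulate⁻ (all⁺ p (allFin _) h)

infixr 4 _⇒ᵇ_
_⇒ᵇ_ : Bool → Bool → Bool
true  ⇒ᵇ b = b
false ⇒ᵇ _ = true

⇒ᵇ-mp : ∀ {a b} → T (a ⇒ᵇ b) → T a → T b
⇒ᵇ-mp {true} h _ = h

allVectorsᵇ : ∀ n → (Vec Bool n → Bool) → Bool
allVectorsᵇ zero    p = p []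
allVectorsᵇ (suc n) p = allVectorsᵇ n (p ∘ (true ∷_)) ∧ allVectorsᵇ n (p ∘ (false ∷_))

allVectorsᵇ-sound : ∀ n {p : Vec Bool n → Bool} → allVectorsᵇ n p ≡ true → ∀ v → p v ≡ true
allVectorsᵇ-sound zero        h []          = h
allVectorsᵇ-sound (suc n) {p} h (true ∷ v)  =
  allVectorsᵇ-sound n (∧-conicalˡ (allVectorsᵇ n (p ∘ (true ∷_))) _ h) v
allVectorsᵇ-sound (suc n) {p} h (false ∷ v) =
  allVectorsᵇ-sound n (∧-conicalʳ (allVectorsᵇ n (p ∘ (true ∷_))) _ h) v

noVertices : Tournament 0
noVertices = record { arc = λ () ; irrefl = λ () ; tourn = λ () }

canonical : Tournament n → Tournament n
canonical {zero}  _ = noVertices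
canonical {suc n} S = extend (outRow S) (canonical (removeZero S))

canonical-≋ : (S : Tournament n) → canonical S ≋ S
canonical-≋ {zero}  S = mk≋ λ ()
canonical-≋ {suc n} S = ≋-trans (extend-cong (outRow S) (canonical-≋ (removeZero S))) (extend-outRow-removeZero S)

allTournamentsᵇ : ∀ n → (Tournament n → Bool) → Bool
allTournamentsᵇ zero    p = p noVertices
allTournamentsᵇ (suc n) p = allTournamentsᵇ n λ S → allVectorsᵇ n λ r → p (extend r S)

allTournamentsᵇ-sound : ∀ n {p : Tournament n → Bool} → allTournamentsᵇ n p ≡ true → ∀ S → p (canonical S) ≡ true
allTournamentsᵇ-sound zero    h S = h
allTournamentsᵇ-sound (suc n) h S = allVectorsᵇ-sound n (allTournamentsᵇ-sound n h (removeZero S)) (outRow S)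

-- Diamonds and δ are switching invariants

isDiamond-cong : {R S : Tournament n} → R ≋ S → ∀ a b c d → isDiamond R a b c d ≡ isDiamond S a b c d
isDiamond-cong (mk≋ e) a b c d
  rewrite e a b | e b a | e a c | e c a | e a d | e d a
        | e b c | e c b | e b d | e d b | e c d | e d c = refl

isDiamond₀₁₂₃-switch : (S : Tournament 4) (W : Fin 4 → Bool) →
  isDiamond (switch S W) (# 0) (# 1) (# 2) (# 3) ≡ isDiamond S (# 0) (# 1) (# 2) (# 3)
isDiamond₀₁₂₃-switch S W = begin
  isDiamond (switch S W) (# 0) (# 1) (# 2) (# 3)
    ≡⟨ isDiamond-cong (switch-cong (≋-sym C≋S) (λ i → sym (lookup∘tabulate W i))) (# 0) (# 1) (# 2) (# 3) ⟩
  isDiamond (switch C (lookup (tabulate W))) (# 0) (# 1) (# 2) (# 3)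
    ≡⟨ toWitness (Equivalence.from T-≡ checked) ⟩
  isDiamond C (# 0) (# 1) (# 2) (# 3)
    ≡⟨ isDiamond-cong C≋S (# 0) (# 1) (# 2) (# 3) ⟩
  isDiamond S (# 0) (# 1) (# 2) (# 3) ∎
  where
  open ≡-Reasoning
  C : Tournament 4
  C = canonical S
  C≋S : C ≋ S
  C≋S = canonical-≋ S
  invariant : Tournament 4 → Vec Bool 4 → Bool
  invariant U V = ⌊ isDiamond (switch U (lookup V)) (# 0) (# 1) (# 2) (# 3) ≟ᵇ isDiamond U (# 0) (# 1) (# 2) (# 3) ⌋
  allChecked : (allTournamentsᵇ 4 λ U → allVectorsᵇ 4 (invariant U)) ≡ true
  allChecked = refl
  checked : invariant C (tabulate W) ≡ true
  checked = allVectorsᵇ-sound 4 {invariant C}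
              (allTournamentsᵇ-sound 4 {λ U → allVectorsᵇ 4 (invariant U)} allChecked S) (tabulate W)

induced : (S : Tournament n) (f : Fin k → Fin n) → Injective _≡_ _≡_ f → Tournament k
induced S f f-inj = record
  { arc    = λ i j → arc S (f i) (f j)
  ; irrefl = λ i → irrefl S (f i)
  ; tourn  = λ i j i≢j → tourn S (f i) (f j) (i≢j ∘ f-inj)
  }

-- Both sides unfold to the corresponding sides of isDiamond₀₁₂₃-switch for the induced tournament.
isDiamond-switch : (S : Tournament n) (W : Fin n → Bool) (f : Fin 4 → Fin n) → Injective _≡_ _≡_ f →
  isDiamond (switch S W) (f (# 0)) (f (# 1)) (f (# 2)) (f (# 3)) ≡ isDiamond S (f (# 0)) (f (# 1)) (f (# 2)) (f (# 3))
isDiamond-switch S W f f-inj = isDiamond₀₁₂₃-switch (induced S f f-inj) (W ∘ f)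

quadVertex : Quad n → Fin 4 → Fin n
quadVertex (quad a b c d) = lookup (a ∷ b ∷ c ∷ d ∷ [])

Increasing : Quad n → Set
Increasing (quad a b c d) = T (lt? a b ∧ lt? b c ∧ lt? c d)

fourSubsets-increasing : All Increasing (fourSubsets n)
fourSubsets-increasing {n} =
  concatMap⁺ λ a → concatMap⁺ λ b → concatMap⁺ λ c → concatMap⁺ λ d →
    guard⁺ (lt? a b ∧ lt? b c ∧ lt? c d) (λ increasing → increasing)
  where
  concatMap⁺ : {f : Fin n → List (Quad n)} → (∀ x → All Increasing (f x)) →
               All Increasing (concatMap f (allFin n))
  concatMap⁺ h = concat⁺ (map⁺ (All.universal h (allFin n)))
  guard⁺ : ∀ b {q} → (T b → Increasing q) → All Increasing (if b then q ∷ [] else [])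
  guard⁺ true  h = h _ ∷ []
  guard⁺ false h = []

increasing-injective : (q : Quad n) → Increasing q → Injective _≡_ _≡_ (quadVertex q)
increasing-injective (quad a b c d) increasing {i} {j} = injective i j
  where
  lt⇒< : ∀ {x y : Fin n} → T (lt? x y) → toℕ x < toℕ y
  lt⇒< = toWitness
  ab,bc∧cd : T (lt? a b) × T (lt? b c ∧ lt? c d)
  ab,bc∧cd = Equivalence.to (T-∧ {lt? a b}) increasing
  bc,cd : T (lt? b c) × T (lt? c d)
  bc,cd = Equivalence.to (T-∧ {lt? b c}) (proj₂ ab,bc∧cd)
  a<b : toℕ a < toℕ b
  a<b = lt⇒< (proj₁ ab,bc∧cd)
  b<c : toℕ b < toℕ c
  b<c = lt⇒< (proj₁ bc,cd)
  c<d : toℕ c < toℕ d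
  c<d = lt⇒< (proj₂ bc,cd)
  a<c : toℕ a < toℕ c
  a<c = <-trans a<b b<c
  b<d : toℕ b < toℕ d
  b<d = <-trans b<c c<d
  a<d : toℕ a < toℕ d
  a<d = <-trans a<c c<d
  distinct : ∀ {x y : Fin n} → toℕ x < toℕ y → x ≢ y
  distinct x<y x≡y = <⇒≢ x<y (cong toℕ x≡y)
  injective : ∀ i j → quadVertex (quad a b c d) i ≡ quadVertex (quad a b c d) j → i ≡ j
  injective zero                   zero                   _ = refl
  injective (suc zero)             (suc zero)             _ = refl
  injective (suc (suc zero))       (suc (suc zero))       _ = refl
  injective (suc (suc (suc zero))) (suc (suc (suc zero))) _ = refl
  injective zero                   (suc zero)             e = ⊥-elim (distinct a<b e)
  injective zero                   (suc (suc zero))       e = ⊥-elim (distinct a<c e)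
  injective zero                   (suc (suc (suc zero))) e = ⊥-elim (distinct a<d e)
  injective (suc zero)             (suc (suc zero))       e = ⊥-elim (distinct b<c e)
  injective (suc zero)             (suc (suc (suc zero))) e = ⊥-elim (distinct b<d e)
  injective (suc (suc zero))       (suc (suc (suc zero))) e = ⊥-elim (distinct c<d e)
  injective (suc zero)             zero                   e = ⊥-elim (distinct a<b (sym e))
  injective (suc (suc zero))       zero                   e = ⊥-elim (distinct a<c (sym e))
  injective (suc (suc (suc zero))) zero                   e = ⊥-elim (distinct a<d (sym e))
  injective (suc (suc zero))       (suc zero)             e = ⊥-elim (distinct b<c (sym e))
  injective (suc (suc (suc zero))) (suc zero)             e = ⊥-elim (distinct b<d (sym e))
  injective (suc (suc (suc zero))) (suc (suc zero))       e = ⊥-elim (distinct c<d (sym e))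

countB-cong : ∀ {A : Set} {p q : A → Bool} {xs : List A} → All (λ x → p x ≡ q x) xs → countB p xs ≡ countB q xs
countB-cong []             = refl
countB-cong (px≡qx ∷ rest) = cong₂ (λ b m → (if b then 1 else 0) + m) px≡qx (countB-cong rest)

δ-cong : {R S : Tournament n} → R ≋ S → δ R ≡ δ S
δ-cong {n} R≋S = countB-cong (All.universal (λ { (quad a b c d) → isDiamond-cong R≋S a b c d }) (fourSubsets n))

δ-switch : (S : Tournament n) (W : Fin n → Bool) → δ (switch S W) ≡ δ S
δ-switch {n} S W = countB-cong {xs = fourSubsets n}
  (All.map (λ { {quad a b c d} increasing → isDiamond-switch S W _ (increasing-injective (quad a b c d) increasing) })
           fourSubsets-increasing)

-- Transitive subtournaments

IsTransitiveEmbedding : Tournament n → (Fin k → Fin n) → Set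
IsTransitiveEmbedding S f = Injective _≡_ _≡_ f × (∀ a b c → ¬ Is3Cycle S (f a) (f b) (f c))

IsTransitiveEmbedding-cong : {R S : Tournament n} {f : Fin k → Fin n} →
                             R ≋ S → IsTransitiveEmbedding R f → IsTransitiveEmbedding S f
IsTransitiveEmbedding-cong (mk≋ e) (f-inj , acyclic) =
  f-inj , λ a b c (ab , bc , ca) → acyclic a b c (trans (e _ _) ab , trans (e _ _) bc , trans (e _ _) ca)

NoIncreasing3Cycle : Tournament n → (Fin k → Fin n) → Set
NoIncreasing3Cycle S f =
  ∀ a b c → a <ᶠ b → b <ᶠ c → ¬ Is3Cycle S (f a) (f b) (f c) × ¬ Is3Cycle S (f a) (f c) (f b)

-- Read a 3-cycle from its least index; it then runs through the other two in one of two orders.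
noIncreasing3Cycle⇒acyclic : (S : Tournament n) (f : Fin k → Fin n) → NoIncreasing3Cycle S f →
                             ∀ a b c → ¬ Is3Cycle S (f a) (f b) (f c)
noIncreasing3Cycle⇒acyclic S f none = acyclic
  where
  rotate : ∀ {x y z} → Is3Cycle S x y z → Is3Cycle S y z x
  rotate (xy , yz , zx) = yz , zx , xy
  no-loop : ∀ {a b} → a ≡ b → ¬ arc S (f a) (f b) ≡ true
  no-loop refl loop with () ← trans (sym (irrefl S _)) loop
  fromLeast : ∀ {a b c} → a <ᶠ b → a <ᶠ c → ¬ Is3Cycle S (f a) (f b) (f c)
  fromLeast {a} {b} {c} a<b a<c cyc with <-cmpᶠ b c
  ... | tri< b<c _ _ = proj₁ (none a b c a<b b<c) cyc
  ... | tri≈ _ b≡c _ = no-loop b≡c (proj₁ (proj₂ cyc))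
  ... | tri> _ _ c<b = proj₂ (none a c b a<c c<b) cyc
  acyclic : ∀ a b c → ¬ Is3Cycle S (f a) (f b) (f c)
  acyclic a b c cyc with <-cmpᶠ a b
  ... | tri≈ _ a≡b _ = no-loop a≡b (proj₁ cyc)
  ... | tri< a<b _ _ with <-cmpᶠ a c
  ...   | tri< a<c _ _ = fromLeast a<b a<c cyc
  ...   | tri≈ _ a≡c _ = no-loop (sym a≡c) (proj₂ (proj₂ cyc))
  ...   | tri> _ _ c<a = fromLeast c<a (<-transᶠ c<a a<b) (rotate (rotate cyc))
  acyclic a b c cyc | tri> _ _ b<a with <-cmpᶠ b c
  ...   | tri< b<c _ _ = fromLeast b<c b<a (rotate cyc)
  ...   | tri≈ _ b≡c _ = no-loop b≡c (proj₁ (proj₂ cyc))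
  ...   | tri> _ _ c<b = fromLeast (<-transᶠ c<b b<a) c<b (rotate (rotate cyc))

not-cyc3?⇒acyclic : (S : Tournament n) {x y z : Fin n} → T (not (cyc3? S x y z)) →
                    ¬ Is3Cycle S x y z × ¬ Is3Cycle S x z y
not-cyc3?⇒acyclic S {x} {y} {z} h = (λ cyc → subst (T ∘ not) (forward cyc) h)
                                   , (λ cyc → subst (T ∘ not) (backward cyc) h)
  where
  forward : Is3Cycle S x y z → cyc3? S x y z ≡ true
  forward (xy , yz , zx) rewrite xy | yz | zx = refl
  backward : Is3Cycle S x z y → cyc3? S x y z ≡ true
  backward (xz , zy , yx) rewrite xz | zy | yx = ∨-zeroʳ _

injectiveᵇ : (Fin k → Fin n) → Bool
injectiveᵇ f = ∀ᵇ λ x → ∀ᵇ λ y → (toℕ (f x) ≡ᵇ toℕ (f y)) ⇒ᵇ (toℕ x ≡ᵇ toℕ y)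

injectiveᵇ-sound : (f : Fin k → Fin n) → T (injectiveᵇ f) → Injective _≡_ _≡_ f
injectiveᵇ-sound f h {x} {y} fx≡fy =
  toℕ-injective (≡ᵇ⇒≡ _ _ (⇒ᵇ-mp (∀ᵇ-sound (∀ᵇ-sound h x) y) (≡⇒≡ᵇ _ _ (cong toℕ fx≡fy))))

noIncreasing3Cycleᵇ : Tournament n → (Fin k → Fin n) → Bool
noIncreasing3Cycleᵇ S f = ∀ᵇ λ a → ∀ᵇ λ b → ∀ᵇ λ c →
  ((toℕ a <ᵇ toℕ b) ∧ (toℕ b <ᵇ toℕ c)) ⇒ᵇ not (cyc3? S (f a) (f b) (f c))

noIncreasing3Cycleᵇ-sound : (S : Tournament n) (f : Fin k → Fin n) →
                            T (noIncreasing3Cycleᵇ S f) → NoIncreasing3Cycle S f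
noIncreasing3Cycleᵇ-sound S f h a b c a<b b<c =
  not-cyc3?⇒acyclic S (⇒ᵇ-mp (∀ᵇ-sound (∀ᵇ-sound (∀ᵇ-sound h a) b) c) (Equivalence.from T-∧ (<⇒<ᵇ a<b , <⇒<ᵇ b<c)))

transitiveᵇ : Tournament n → (Fin k → Fin n) → Bool
transitiveᵇ S f = injectiveᵇ f ∧ noIncreasing3Cycleᵇ S f

transitiveᵇ-sound : (S : Tournament n) (f : Fin k → Fin n) → T (transitiveᵇ S f) → IsTransitiveEmbedding S f
transitiveᵇ-sound S f h with Equivalence.to (T-∧ {injectiveᵇ f}) h
... | injective , acyclic =
  injectiveᵇ-sound f injective , noIncreasing3Cycle⇒acyclic S f (noIncreasing3Cycleᵇ-sound S f acyclic)

SwitchesToTransitive : ℕ → Tournament n → Set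
SwitchesToTransitive {n} k S = Σ (Fin n → Bool) λ W → HasTransitiveSub k (switch S W)

switchesToTransitive-cong : {R S : Tournament n} → R ≋ S → SwitchesToTransitive k R → SwitchesToTransitive k S
switchesToTransitive-cong R≋S (W , f , transitive) =
  W , f , IsTransitiveEmbedding-cong (switch-cong {V = W} R≋S λ _ → refl) transitive

switchesToTransitive-switch : (S : Tournament n) (V : Fin n → Bool) →
                              SwitchesToTransitive k (switch S V) → SwitchesToTransitive k S
switchesToTransitive-switch S V (W , f , transitive) =
  (λ u → V u xor W u) , f , IsTransitiveEmbedding-cong (switch-switch S V W) transitive

switchingEquivalentWithTransitive : (S : Tournament n) → SwitchesToTransitive k S →
  Σ (Tournament n) λ S′ → SwitchingEquivalent S S′ × HasTransitiveSub k S′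
switchingEquivalentWithTransitive S (W , sub) = switch S W , (W , λ _ _ → refl) , sub

certifiesᵇ : Tournament n → Fin n × (Fin k → Fin n) → Bool
certifiesᵇ S (v , f) = transitiveᵇ (switch S (inNeighbours S v)) f

certified⇒switchesToTransitive : (S : Tournament n) (cs : List (Fin n × (Fin k → Fin n))) →
                                 any (certifiesᵇ S) cs ≡ true → SwitchesToTransitive k S
certified⇒switchesToTransitive S cs h
  with Any.satisfied (any⁻ (certifiesᵇ S) cs (Equivalence.from (T-≡ {any (certifiesᵇ S) cs}) h))
... | (v , f) , certified = inNeighbours S v , f , transitiveᵇ-sound (switch S (inNeighbours S v)) f certified

-- Six vertices, vertex 0 a source

subsets : ∀ k n → List (Vec (Fin n) k)
subsets zero    n       = [] ∷ []
subsets (suc k) zero    = []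
subsets (suc k) (suc n) = map (λ s → zero ∷ Vec.map suc s) (subsets k n) ++ map (Vec.map suc) (subsets (suc k) n)

toQuad : Vec (Fin n) 4 → Quad n
toQuad (a ∷ b ∷ c ∷ d ∷ []) = quad a b c d

-- The same list of 4-subsets as fourSubsets 6, hence δ₆ ≡ δ by refl, but generated without
-- filtering 6⁴ tuples, so that it is cheap to evaluate in the exhaustive check below.
δ₆ : Tournament 6 → ℕ
δ₆ S = countB (λ { (quad a b c d) → isDiamond S a b c d }) (map toQuad (subsets 4 6))

δ₆≡δ : (S : Tournament 6) → δ₆ S ≡ δ S
δ₆≡δ S = refl

candidates : (k : ℕ) → List (Fin 6 × (Fin k → Fin 6))
candidates k = cartesianProductWith (λ v s → v , lookup s) (allFin 6) (subsets k 6)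

Conclusion : Tournament n → Set
Conclusion S = SwitchesToTransitive 4 S × (δ S < 6 → SwitchesToTransitive 5 S)

conclusion-cong : {R S : Tournament n} → R ≋ S → Conclusion R → Conclusion S
conclusion-cong R≋S (sub₄ , sub₅) =
  switchesToTransitive-cong R≋S sub₄ ,
  λ δ<6 → switchesToTransitive-cong R≋S (sub₅ (subst (_< 6) (sym (δ-cong R≋S)) δ<6))

certificateCheck : Tournament 6 → Bool
certificateCheck S = any (certifiesᵇ S) (candidates 4) ∧ ((6 ≤ᵇ δ₆ S) ∨ any (certifiesᵇ S) (candidates 5))

certificateCheck-sound : (S : Tournament 6) → certificateCheck S ≡ true → Conclusion S
certificateCheck-sound S h =
  certified⇒switchesToTransitive S (candidates 4) (∧-conicalˡ any₄ (δ≥6 ∨ any₅) h) ,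
  λ δ<6 → [ (λ 6≤δ → ⊥-elim (<⇒≱ δ<6 (subst (6 ≤_) (δ₆≡δ S) (≤ᵇ⇒≤ 6 (δ₆ S) 6≤δ))))
          , certified⇒switchesToTransitive S (candidates 5) ∘ Equivalence.to T-≡ ]
          (Equivalence.to (T-∨ {δ≥6} {any₅}) (Equivalence.from (T-≡ {δ≥6 ∨ any₅}) (∧-conicalʳ any₄ (δ≥6 ∨ any₅) h)))
  where
  any₄ any₅ δ≥6 : Bool
  any₄ = any (certifiesᵇ S) (candidates 4)
  any₅ = any (certifiesᵇ S) (candidates 5)
  δ≥6  = 6 ≤ᵇ δ₆ S

allConesChecked : allTournamentsᵇ 5 (λ R → certificateCheck (addSource R)) ≡ true
allConesChecked = refl

conclusion-addSource : (R : Tournament 5) → Conclusion (addSource R)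
conclusion-addSource R =
  conclusion-cong (addSource-cong (canonical-≋ R))
    (certificateCheck-sound (addSource (canonical R))
      (allTournamentsᵇ-sound 5 {λ R → certificateCheck (addSource R)} allConesChecked R))

proposition2p7 : (T : Tournament 6) →
    (Σ (Tournament 6) λ T' → SwitchingEquivalent T T' × HasTransitiveSub 4 T')
    × (δ T < 6 → Σ (Tournament 6) λ T'' → SwitchingEquivalent T T'' × HasTransitiveSub 5 T'')
proposition2p7 S =
  fromSwitch (proj₁ switched) , λ δ<6 → fromSwitch (proj₂ switched (subst (_< 6) (sym (δ-switch S W₀)) δ<6))
  where
  W₀ : Fin 6 → Bool
  W₀ = inNeighbours S zero
  switched : Conclusion (switch S W₀)
  switched = conclusion-cong (addSource-removeZero (switch S W₀) (switch-inNeighbours-isSource S zero))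
                             (conclusion-addSource (removeZero (switch S W₀)))
  fromSwitch : ∀ {k} → SwitchesToTransitive k (switch S W₀) →
               Σ (Tournament 6) λ S′ → SwitchingEquivalent S S′ × HasTransitiveSub k S′
  fromSwitch = switchingEquivalentWithTransitive S ∘ switchesToTransitive-switch S W₀
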